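{- Let $A$ and $B$ be the well-formed environments $A=\{\!\{\{\!\{e_1,nl_1,ol_2,e_2\}\!\},\, nl_2+(nl_1\mathbin{\dot- } ol_2),\, ol_3,\, e_3\}\!\}$ and $B=\{\!\{e_1,\, nl_1,\, ol_2+(ol_3\mathbin{\dot- } nl_2),\, \{\!\{e_2,nl_2,ol_3,e_3\}\!\}\}\!\}$. Then there is a simple environment $C$ such that $A\rhd_{rm}^* C$ and $B\rhd_{rm}^* C$.
   Context: Suspension calculus with meta variables. Terms $t ::= c \mid v \mid \#i \mid (t\ t)\mid(\lambda\, t)\mid [\![t,n,n,e]\!]$, environments $e::= nil\mid ((t,n)::e)\mid \{\!\{e,n,n,e\}\!\}$ ($c$ constants, $v$ meta variables, $n$ naturals, $i$ positive integers). $m\mathbin{\dot- } n=\max(m-n,0)$. Length: $len(nil)=0$, $len((t,l)::e)=1+len(e)$, $len(\{\!\{e_1,nl_1,ol_2,e_2\}\!\})=len(e_1)+(len(e_2)\mathbin{\dot- } nl_1)$. Level: $lev(nil)=0$, $lev((t,l)::e)=l$, $lev(\{\!\{e_1,nl_1,ol_2,e_2\}\!\})=lev(e_2)+(nl_1\mathbin{\dot- } ol_2)$. Well-formed: every subexpression satisfies: $[\![t,ol,nl,e]\!]$ has $len(e)=ol$, $lev(e)\le nl$; $(t,l)::e$ has $l\ge lev(e)$; $\{\!\{e_1,nl_1,ol_2,e_2\}\!\}$ has $lev(e_1)\le nl_1$, $len(e_2)=ol_2$. Only well-formed expressions are considered. A simple environment is one of the form $(t_0,l_0)::\cdots::(t_{k-1},l_{k-1})::nil$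 ($k\ge0$). Reading rules: (r1) $[\![c,ol,nl,e]\!]\to c$; (r2) $[\![\#i,0,nl,nil]\!]\to\#(i+nl)$; (r3) $[\![\#1,ol,nl,(t,l)::e]\!]\to[\![t,0,nl-l,nil]\!]$; (r4) $[\![\#i,ol,nl,(t,l)::e]\!]\to[\![\#(i-1),ol-1,nl,e]\!]$ if $i>1$; (r5) $[\![(t_1\ t_2),ol,nl,e]\!]\to([\![t_1,ol,nl,e]\!]\ [\![t_2,ol,nl,e]\!])$; (r6) $[\![(\lambda t),ol,nl,e]\!]\to(\lambda [\![t,ol+1,nl+1,(\#1,nl+1)::e]\!])$. Merging rules: (m1) $[\![[\![t,ol_1,nl_1,e_1]\!],ol_2,nl_2,e_2]\!]\to[\![t,ol_1+(ol_2\mathbin{\dot- } nl_1),nl_2+(nl_1\mathbin{\dot- } ol_2),\{\!\{e_1,nl_1,ol_2,e_2\}\!\}]\!]$; (m2) $\{\!\{e_1,nl_1,0,nil\}\!\}\to e_1$; (m3) $\{\!\{nil,0,ol_2,e_2\}\!\}\to e_2$; (m4) $\{\!\{nil,nl_1,ol_2,(t,l)::e_2\}\!\}\to\{\!\{nil,nl_1-1,ol_2-1,e_2\}\!\}$ if $nl_1\ge1$; (m5) $\{\!\{(t,n)::e_1,nl_1,ol_2,(s,l)::e_2\}\!\}\to\{\!\{(t,n)::e_1,nl_1-1,ol_2-1,e_2\}\!\}$ if $nl_1>n$; (m6) $\{\!\{(t,n)::e_1,n,ol_2,(s,l)::e_2\}\!\}\to([\![t,ol_2,l,(s,l)::e_2]\!],l+(n\mathbin{\dot-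 } ol_2))::\{\!\{e_1,n,ol_2,(s,l)::e_2\}\!\}$. No rule acts on meta variables. $x\rhd_{rm}y$: $y$ results from $x$ by one of these rules at some subexpression; $\rhd_{rm}^*$ is its reflexive–transitive closure. -}

module Defs where

open import Data.Nat using (ℕ; zero; suc; _+_; _∸_; _≤_; _<_; _≥_; _>_)
open import Relation.Binary.PropositionalEquality using (_≡_)
open import Relation.Binary.Construct.Closure.ReflexiveTransitive using (Star)

-- Suspension calculus with meta variables.
-- Constants and meta variables are named by natural numbers.
-- De Bruijn index #i (i ≥ 1) is represented as  var k  with i = k + 1.
mutual
  data Term : Set where
    const : ℕ → Term
    meta  : ℕ → Term
    var   : ℕ → Term
    app   : Term → Term → Term
    lam   : Term → Term
    susp  : Term → ℕ → ℕ → Env → Term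

  data Env : Set where
    nil   : Env
    cons  : Term → ℕ → Env → Env
    merge : Env → ℕ → ℕ → Env → Env

len : Env → ℕ
len nil = 0
len (cons t l e) = suc (len e)
len (merge e₁ nl₁ ol₂ e₂) = len e₁ + (len e₂ ∸ nl₁)

lev : Env → ℕ
lev nil = 0
lev (cons t l e) = l
lev (merge e₁ nl₁ ol₂ e₂) = lev e₂ + (nl₁ ∸ ol₂)

mutual
  data WFTerm : Term → Set where
    wf-const : ∀ {c} → WFTerm (const c)
    wf-meta  : ∀ {v} → WFTerm (meta v)
    wf-var   : ∀ {k} → WFTerm (var k)
    wf-app   : ∀ {t₁ t₂} → WFTerm t₁ → WFTerm t₂ → WFTerm (app t₁ t₂)
    wf-lam   : ∀ {t} → WFTerm t → WFTerm (lam t)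
    wf-susp  : ∀ {t ol nl e} → WFTerm t → WFEnv e →
               len e ≡ ol → lev e ≤ nl → WFTerm (susp t ol nl e)

  data WFEnv : Env → Set where
    wf-nil   : WFEnv nil
    wf-cons  : ∀ {t l e} → WFTerm t → WFEnv e → l ≥ lev e → WFEnv (cons t l e)
    wf-merge : ∀ {e₁ nl₁ ol₂ e₂} → WFEnv e₁ → WFEnv e₂ →
               lev e₁ ≤ nl₁ → len e₂ ≡ ol₂ → WFEnv (merge e₁ nl₁ ol₂ e₂)

data Simple : Env → Set where
  simple-nil  : Simple nil
  simple-cons : ∀ {t l e} → Simple e → Simple (cons t l e)

data TermRule : Term → Term → Set where
  r1 : ∀ {c ol nl e} → TermRule (susp (const c) ol nl e) (const c)
  r2 : ∀ {k nl} → TermRule (susp (var k) 0 nl nil) (var (k + nl))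
  r3 : ∀ {ol nl t l e} →
       TermRule (susp (var 0) ol nl (cons t l e)) (susp t 0 (nl ∸ l) nil)
  r4 : ∀ {k ol nl t l e} →
       TermRule (susp (var (suc k)) ol nl (cons t l e)) (susp (var k) (ol ∸ 1) nl e)
  r5 : ∀ {t₁ t₂ ol nl e} →
       TermRule (susp (app t₁ t₂) ol nl e) (app (susp t₁ ol nl e) (susp t₂ ol nl e))
  r6 : ∀ {t ol nl e} →
       TermRule (susp (lam t) ol nl e)
                (lam (susp t (suc ol) (suc nl) (cons (var 0) (suc nl) e)))
  m1 : ∀ {t ol₁ nl₁ e₁ ol₂ nl₂ e₂} →
       TermRule (susp (susp t ol₁ nl₁ e₁) ol₂ nl₂ e₂)
                (susp t (ol₁ + (ol₂ ∸ nl₁)) (nl₂ + (nl₁ ∸ ol₂)) (merge e₁ nl₁ ol₂ e₂))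

data EnvRule : Env → Env → Set where
  m2 : ∀ {e₁ nl₁} → EnvRule (merge e₁ nl₁ 0 nil) e₁
  m3 : ∀ {ol₂ e₂} → EnvRule (merge nil 0 ol₂ e₂) e₂
  m4 : ∀ {nl₁ ol₂ t l e₂} → nl₁ ≥ 1 →
       EnvRule (merge nil nl₁ ol₂ (cons t l e₂)) (merge nil (nl₁ ∸ 1) (ol₂ ∸ 1) e₂)
  m5 : ∀ {t n e₁ nl₁ ol₂ s l e₂} → nl₁ > n →
       EnvRule (merge (cons t n e₁) nl₁ ol₂ (cons s l e₂))
               (merge (cons t n e₁) (nl₁ ∸ 1) (ol₂ ∸ 1) e₂)
  m6 : ∀ {t n e₁ ol₂ s l e₂} →
       EnvRule (merge (cons t n e₁) n ol₂ (cons s l e₂))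
               (cons (susp t ol₂ l (cons s l e₂)) (l + (n ∸ ol₂))
                     (merge e₁ n ol₂ (cons s l e₂)))

mutual
  data _▷T_ : Term → Term → Set where
    rootT  : ∀ {t u} → TermRule t u → t ▷T u
    app₁   : ∀ {t t' u} → t ▷T t' → app t u ▷T app t' u
    app₂   : ∀ {t u u'} → u ▷T u' → app t u ▷T app t u'
    lam₁   : ∀ {t t'} → t ▷T t' → lam t ▷T lam t'
    susp₁  : ∀ {t t' ol nl e} → t ▷T t' → susp t ol nl e ▷T susp t' ol nl e
    susp₂  : ∀ {t ol nl e e'} → e ▷E e' → susp t ol nl e ▷T susp t ol nl e'

  data _▷E_ : Env → Env → Set where
    rootE  : ∀ {e f} → EnvRule e f → e ▷E f
    cons₁  : ∀ {t t' l e} → t ▷T t' → cons t l e ▷E cons t' l e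
    cons₂  : ∀ {t l e e'} → e ▷E e' → cons t l e ▷E cons t l e'
    merge₁ : ∀ {e₁ e₁' nl ol e₂} → e₁ ▷E e₁' → merge e₁ nl ol e₂ ▷E merge e₁' nl ol e₂
    merge₂ : ∀ {e₁ nl ol e₂ e₂'} → e₂ ▷E e₂' → merge e₁ nl ol e₂ ▷E merge e₁ nl ol e₂'

_▷E*_ : Env → Env → Set
_▷E*_ = Star _▷E_

-- A simple environment whose levels never increase is a normal form, and the merge
-- {{E, nl, ol, F}} of two such environments rewrites to one computed entrywise
-- (flatMerge): each entry of E survives or becomes a suspension over a suffix of F,
-- and the part of F beyond nl follows. Flattening merges inside out thus rewrites every
-- well-formed environment to a normal form; C is the normal form of B. The normal form
-- of A agrees with it except at entries of e₁ suspended first over a suffix Y of e₂ and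
-- then over a suffix Z of e₃; there one (m1) step and flattening {{Y, _, _, Z}} yield
-- the entry of B, a suspension over the corresponding suffix of {{e₂, nl₂, ol₃, e₃}}.

module Submission where

open import Defs
open import Data.Nat using (ℕ; zero; suc; _+_; _∸_; _≤_; _<_; _≤ᵇ_; z≤n; s≤s; s≤s⁻¹)
open import Data.Nat.Properties
open import Data.Bool using (Bool; true; false; if_then_else_)
open import Data.Product using (Σ; _×_; _,_; proj₁; proj₂)
open import Data.Sum using (inj₁; inj₂)
open import Data.Empty using (⊥-elim)
open import Relation.Nullary.Reflects using (Reflects; ofʸ; ofⁿ)
open import Relation.Binary.PropositionalEquality
open import Relation.Binary.Construct.Closure.ReflexiveTransitive using (Star; ε; _◅_; _◅◅_; gmap)
open import Relation.Binary.Construct.Closure.ReflexiveTransitive.Properties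
  using (reflexive; module StarReasoning)
open import Algebra.Properties.CommutativeSemigroup +-commutativeSemigroup using (x∙yz≈y∙xz)

_▷T*_ : Term → Term → Set
_▷T*_ = Star _▷T_

[m+n]∸o≡[m∸o]+[n∸[o∸m]] : ∀ m n o → (m + n) ∸ o ≡ (m ∸ o) + (n ∸ (o ∸ m))
[m+n]∸o≡[m∸o]+[n∸[o∸m]] zero    n zero    = refl
[m+n]∸o≡[m∸o]+[n∸[o∸m]] zero    n (suc o) = refl
[m+n]∸o≡[m∸o]+[n∸[o∸m]] (suc m) n zero    = refl
[m+n]∸o≡[m∸o]+[n∸[o∸m]] (suc m) n (suc o) = [m+n]∸o≡[m∸o]+[n∸[o∸m]] m n o

[m+[n∸o]]∸p≡n∸[o+[p∸m]] : ∀ m n o p → m ≤ p → (m + (n ∸ o)) ∸ p ≡ n ∸ (o + (p ∸ m))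
[m+[n∸o]]∸p≡n∸[o+[p∸m]] m n o p m≤p = begin
  (m + (n ∸ o)) ∸ p             ≡⟨ cong ((m + (n ∸ o)) ∸_) (sym (m+[n∸m]≡n m≤p)) ⟩
  (m + (n ∸ o)) ∸ (m + (p ∸ m)) ≡⟨ [m+n]∸[m+o]≡n∸o m (n ∸ o) (p ∸ m) ⟩
  (n ∸ o) ∸ (p ∸ m)             ≡⟨ ∸-+-assoc n o (p ∸ m) ⟩
  n ∸ (o + (p ∸ m))             ∎
  where open ≡-Reasoning

m+[[n+[o+p]]∸o]≡n+[m+p] : ∀ m n o p → m + ((n + (o + p)) ∸ o) ≡ n + (m + p)
m+[[n+[o+p]]∸o]≡n+[m+p] m n o p = begin
  m + ((n + (o + p)) ∸ o) ≡⟨ cong (λ x → m + (x ∸ o)) (x∙yz≈y∙xz n o p) ⟩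
  m + ((o + (n + p)) ∸ o) ≡⟨ cong (m +_) (m+n∸m≡n o (n + p)) ⟩
  m + (n + p)             ≡⟨ x∙yz≈y∙xz m n p ⟩
  n + (m + p)             ∎
  where open ≡-Reasoning

n≤m⇒o≤m∸n⇒n≤m∸o : ∀ {m n o} → n ≤ m → o ≤ m ∸ n → n ≤ m ∸ o
n≤m⇒o≤m∸n⇒n≤m∸o {m} {n} {o} n≤m o≤m∸n =
  m+n≤o⇒m≤o∸n n (subst (_≤ m) (+-comm o n) (m≤o∸n⇒m+n≤o o n≤m o≤m∸n))

data Sorted : Env → Set where
  sorted-nil  : Sorted nil
  sorted-cons : ∀ {t l e} → Sorted e → lev e ≤ l → Sorted (cons t l e)

Sorted⇒Simple : ∀ {e} → Sorted e → Simple e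
Sorted⇒Simple sorted-nil        = simple-nil
Sorted⇒Simple (sorted-cons s _) = simple-cons (Sorted⇒Simple s)

drop : ℕ → Env → Env
drop zero    e            = e
drop (suc k) (cons t l e) = drop k e
drop (suc k) _            = nil

drop-nil : ∀ k → drop k nil ≡ nil
drop-nil zero    = refl
drop-nil (suc k) = refl

drop-drop : ∀ j k F → drop k (drop j F) ≡ drop (j + k) F
drop-drop zero    k F               = refl
drop-drop (suc j) k nil             = drop-nil k
drop-drop (suc j) k (cons t l F)    = drop-drop j k F
drop-drop (suc j) k (merge _ _ _ _) = drop-nil k

drop-sorted : ∀ {F} → Sorted F → ∀ k → Sorted (drop k F)
drop-sorted s                 zero    = s
drop-sorted sorted-nil        (suc k) = sorted-nil
drop-sorted (sorted-cons s _) (suc k) = drop-sorted s k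

len-drop : ∀ {F} → Sorted F → ∀ k → len (drop k F) ≡ len F ∸ k
len-drop s                 zero    = refl
len-drop sorted-nil        (suc k) = refl
len-drop (sorted-cons s _) (suc k) = len-drop s k

drop-≥len : ∀ {F} → Sorted F → ∀ {k} → len F ≤ k → drop k F ≡ nil
drop-≥len sorted-nil        {zero}  _         = refl
drop-≥len sorted-nil        {suc k} _         = refl
drop-≥len (sorted-cons s _) {suc k} (s≤s len≤k) = drop-≥len s len≤k

lev-drop≤lev : ∀ {F} → Sorted F → ∀ k → lev (drop k F) ≤ lev F
lev-drop≤lev s                 zero    = ≤-refl
lev-drop≤lev sorted-nil        (suc k) = z≤n
lev-drop≤lev (sorted-cons s p) (suc k) = ≤-trans (lev-drop≤lev s k) p

lev-drop-antitone : ∀ {F} → Sorted F → ∀ {j k} → j ≤ k → lev (drop k F) ≤ lev (drop j F)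
lev-drop-antitone {F} s {j} j≤k with m≤n⇒∃[o]m+o≡n j≤k
... | i , refl = subst (λ Y → lev Y ≤ lev (drop j F)) (drop-drop j i F)
                       (lev-drop≤lev (drop-sorted s j) i)

Entry : Set
Entry = Term × ℕ

infixr 25 _∷ₑ_

_∷ₑ_ : Entry → Env → Env
(t , l) ∷ₑ e = cons t l e

record _▷ₑ*_ (x y : Entry) : Set where
  constructor _,_
  field
    term▷* : proj₁ x ▷T* proj₁ y
    level≡ : proj₂ x ≡ proj₂ y

▷ₑ*-reflexive : ∀ {x y} → x ≡ y → x ▷ₑ* y
▷ₑ*-reflexive refl = ε , refl

∷ₑ-▷* : ∀ {x y e f} → x ▷ₑ* y → e ▷E* f → x ∷ₑ e ▷E* y ∷ₑ f
∷ₑ-▷* {t , l} {t' , .l} {e} (t▷t' , refl) e▷f =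
  gmap (λ u → cons u l e) cons₁ t▷t' ◅◅ gmap (cons t' l) cons₂ e▷f

suspendedEntry : Term → ℕ → Env → ℕ → Entry
suspendedEntry t ol Y k = susp t ol (lev Y) Y , lev Y + k

suspendedEntry-cong : ∀ {t ol ol' Y Y' k k'} → ol ≡ ol' → Y ≡ Y' → k ≡ k' →
                      suspendedEntry t ol Y k ≡ suspendedEntry t ol' Y' k'
suspendedEntry-cong refl refl refl = refl

-- In {{E, nl, ol, F}} the entry (t , n) of E is passed by d = nl ∸ n entries of F
-- through (m5); if F is exhausted by then it survives unchanged (m2), otherwise (m6)
-- suspends it over Y = drop d F, with level lev Y + (n ∸ (ol ∸ d)) = lev Y + (nl ∸ ol).
push : ℕ → ℕ → Env → Entry → Entry
push nl ol F (t , n) =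
  if ol ≤ᵇ nl ∸ n then (t , n) else suspendedEntry t (ol ∸ (nl ∸ n)) (drop (nl ∸ n) F) (nl ∸ ol)

flatMerge : Env → ℕ → ℕ → Env → Env
flatMerge nil             nl ol F = drop nl F
flatMerge (cons t n E)    nl ol F = push nl ol F (t , n) ∷ₑ flatMerge E nl ol F
flatMerge (merge _ _ _ _) nl ol F = nil

data PushView (d nl ol : ℕ) (F : Env) (x : Entry) : Set where
  kept   : ol ≤ d → push nl ol F x ≡ x → PushView d nl ol F x
  pushed : d < ol → push nl ol F x ≡ suspendedEntry (proj₁ x) (ol ∸ d) (drop d F) (nl ∸ ol) →
           PushView d nl ol F x

pushView : ∀ nl ol F t n → PushView (nl ∸ n) nl ol F (t , n)
pushView nl ol F t n = view (ol ≤ᵇ nl ∸ n) refl (≤ᵇ-reflects-≤ ol (nl ∸ n))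
  where
    select : Bool → Entry
    select b = if b then (t , n) else suspendedEntry t (ol ∸ (nl ∸ n)) (drop (nl ∸ n) F) (nl ∸ ol)
    view : ∀ b → (ol ≤ᵇ nl ∸ n) ≡ b → Reflects (ol ≤ nl ∸ n) b → PushView (nl ∸ n) nl ol F (t , n)
    view true  eq (ofʸ ol≤d) = kept ol≤d (cong select eq)
    view false eq (ofⁿ ol≰d) = pushed (≰⇒> ol≰d) (cong select eq)

pushView+ : ∀ {nl} ol F t n d → nl ≡ n + d → PushView d nl ol F (t , n)
pushView+ ol F t n d refl =
  subst (λ d' → PushView d' (n + d) ol F (t , n)) (m+n∸m≡n n d) (pushView (n + d) ol F t n)

push-shift : ∀ {nl ol s l F t n} → n ≤ nl →
             push (suc nl) (suc ol) (cons s l F) (t , n) ≡ push nl ol F (t , n)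
push-shift {ol = ol} {s} {l} {F} {t} {n} n≤nl with m≤n⇒∃[o]m+o≡n n≤nl
... | d , refl with pushView+ (suc ol) (cons s l F) t n (suc d) (sym (+-suc n d))
                  | pushView+ ol F t n d refl
... | kept _ e   | kept _ f   = trans e (sym f)
... | pushed _ e | pushed _ f = trans e (sym f)
... | kept p _   | pushed q _ = ⊥-elim (<⇒≱ q (s≤s⁻¹ p))
... | pushed p _ | kept q _   = ⊥-elim (<⇒≱ (s≤s⁻¹ p) q)

flatMerge-shift : ∀ {nl ol s l F E} → Sorted E → lev E ≤ nl →
                  flatMerge E (suc nl) (suc ol) (cons s l F) ≡ flatMerge E nl ol F
flatMerge-shift sorted-nil         _    = refl
flatMerge-shift (sorted-cons sE p) n≤nl =
  cong₂ _∷ₑ_ (push-shift n≤nl) (flatMerge-shift sE (≤-trans p n≤nl))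

flatMerge-drop : ∀ {nl ol E F} → Sorted E → lev E ≤ nl → Sorted F → ∀ k → k ≤ len F →
                 flatMerge E (k + nl) (k + ol) F ≡ flatMerge E nl ol (drop k F)
flatMerge-drop sE lev≤ sF                zero    _         = refl
flatMerge-drop {nl} sE lev≤ (sorted-cons sF _) (suc k) (s≤s k≤len) =
  trans (flatMerge-shift sE (≤-trans lev≤ (m≤n+m nl k))) (flatMerge-drop sE lev≤ sF k k≤len)

flatMerge-skip : ∀ {nl ol E F} → Sorted E → Sorted F → len F ≡ ol → ol + lev E ≤ nl →
                 flatMerge E nl ol F ≡ E
flatMerge-skip {nl} {ol} sorted-nil sF refl ol≤nl =
  drop-≥len sF (≤-trans (m≤m+n ol 0) ol≤nl)
flatMerge-skip {nl} {ol} {cons t m E} {F} (sorted-cons sE p) sF lenF ol+m≤nl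
  with pushView nl ol F t m
... | kept _ e    = cong₂ _∷ₑ_ e (flatMerge-skip sE sF lenF (≤-trans (+-monoʳ-≤ ol p) ol+m≤nl))
... | pushed d<ol _ = ⊥-elim (<⇒≱ d<ol (m+n≤o⇒m≤o∸n ol ol+m≤nl))

drop-flatMerge : ∀ {nl ol E F} → Sorted E → ∀ k →
                 drop k (flatMerge E nl ol F) ≡ flatMerge (drop k E) (nl + (k ∸ len E)) ol F
drop-flatMerge {nl} {ol} {E} {F} _ zero =
  cong (λ nl' → flatMerge E nl' ol F) (sym (trans (cong (nl +_) (0∸n≡0 (len E))) (+-identityʳ nl)))
drop-flatMerge {nl} {F = F} sorted-nil (suc k) = drop-drop nl (suc k) F
drop-flatMerge (sorted-cons sE _) (suc k) = drop-flatMerge sE k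

drop-flatMerge-past : ∀ {nl ol E F} → Sorted E → ∀ k →
                      drop (len E + k) (flatMerge E nl ol F) ≡ drop (nl + k) F
drop-flatMerge-past {nl} {F = F} sorted-nil k = drop-drop nl k F
drop-flatMerge-past (sorted-cons sE _) k = drop-flatMerge-past sE k

push-immediate : ∀ t n s l F →
  push n (suc (len F)) (cons s l F) (t , n)
  ≡ suspendedEntry t (suc (len F)) (cons s l F) (n ∸ suc (len F))
push-immediate t n s l F with pushView+ (suc (len F)) (cons s l F) t n 0 (sym (+-identityʳ n))
... | pushed _ e = e

merge▷*flatMerge : ∀ E nl ol F → Sorted E → lev E ≤ nl → Sorted F → len F ≡ ol →
                   merge E nl ol F ▷E* flatMerge E nl ol F
merge▷*flatMerge E nl .0 nil sE lev≤ _ refl =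
  rootE m2 ◅ reflexive _▷E_ (sym (flatMerge-skip sE sorted-nil refl lev≤))
merge▷*flatMerge nil zero ol (cons _ _ _) _ _ _ _ = rootE m3 ◅ ε
merge▷*flatMerge nil (suc nl) .(suc (len F)) (cons s l F) _ _ (sorted-cons sF _) refl =
  rootE (m4 (s≤s z≤n)) ◅ merge▷*flatMerge nil nl (len F) F sorted-nil z≤n sF refl
merge▷*flatMerge (cons t n E) nl .(suc (len F)) (cons s l F)
                 (sorted-cons sE p) n≤nl (sorted-cons sF q) refl with m≤n⇒m<n∨m≡n n≤nl
... | inj₁ (s≤s {n = nl'} n≤nl') =
  rootE (m5 (s≤s n≤nl'))
  ◅ merge▷*flatMerge (cons t n E) nl' (len F) F (sorted-cons sE p) n≤nl' sF refl
  ◅◅ reflexive _▷E_ (sym (flatMerge-shift (sorted-cons sE p) n≤nl'))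
... | inj₂ refl =
  rootE m6 ◅ ∷ₑ-▷* (▷ₑ*-reflexive (sym (push-immediate t n s l F)))
                    (merge▷*flatMerge E n (suc (len F)) (cons s l F) sE p (sorted-cons sF q) refl)

flatMerge-len : ∀ {nl ol E F} → Sorted E → Sorted F →
                len (flatMerge E nl ol F) ≡ len E + (len F ∸ nl)
flatMerge-len {nl} sorted-nil        sF = len-drop sF nl
flatMerge-len      (sorted-cons sE _) sF = cong suc (flatMerge-len sE sF)

flatMerge-lev : ∀ {nl ol E F} → Sorted E → lev E ≤ nl → Sorted F →
                lev (flatMerge E nl ol F) ≤ lev F + (nl ∸ ol)
flatMerge-lev {nl} sorted-nil _ sF = ≤-trans (lev-drop≤lev sF nl) (m≤m+n _ _)
flatMerge-lev {nl} {ol} {cons t n E} {F} (sorted-cons _ _) n≤nl sF with pushView nl ol F t n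
... | kept ol≤d e rewrite e = ≤-trans (n≤m⇒o≤m∸n⇒n≤m∸o n≤nl ol≤d) (m≤n+m _ _)
... | pushed _ e  rewrite e = +-monoˡ-≤ (nl ∸ ol) (lev-drop≤lev sF (nl ∸ n))

push-lev-mono : ∀ {nl ol F t t' m n} → Sorted F → m ≤ n → n ≤ nl →
                proj₂ (push nl ol F (t' , m)) ≤ proj₂ (push nl ol F (t , n))
push-lev-mono {nl} {ol} {F} {t} {t'} {m} {n} sF m≤n n≤nl
  with pushView nl ol F t n | pushView nl ol F t' m
... | kept _ e    | kept _ f    rewrite e | f = m≤n
... | kept p _    | pushed q _  = ⊥-elim (<⇒≱ q (≤-trans p (∸-monoʳ-≤ nl m≤n)))
... | pushed _ e  | kept q f    rewrite e | f =
  ≤-trans (n≤m⇒o≤m∸n⇒n≤m∸o (≤-trans m≤n n≤nl) q) (m≤n+m _ _)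
... | pushed _ e  | pushed _ f  rewrite e | f =
  +-monoˡ-≤ (nl ∸ ol) (lev-drop-antitone sF (∸-monoʳ-≤ nl m≤n))

lev-drop≤push : ∀ {nl ol F t n} → Sorted F → len F ≡ ol → n ≤ nl →
                lev (drop nl F) ≤ proj₂ (push nl ol F (t , n))
lev-drop≤push {nl} {ol} {F} {t} {n} sF lenF n≤nl with pushView nl ol F t n
... | kept ol≤d _
  rewrite drop-≥len sF (≤-trans (≤-reflexive lenF) (≤-trans ol≤d (m∸n≤m nl n))) = z≤n
... | pushed _ e  rewrite e = ≤-trans (lev-drop-antitone sF (m∸n≤m nl n)) (m≤m+n _ _)

lev-flatMerge≤push : ∀ {nl ol E F t n} → Sorted E → lev E ≤ n → n ≤ nl → Sorted F → len F ≡ ol →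
                     lev (flatMerge E nl ol F) ≤ proj₂ (push nl ol F (t , n))
lev-flatMerge≤push sorted-nil _ n≤nl sF lenF = lev-drop≤push sF lenF n≤nl
lev-flatMerge≤push {nl} {ol} {cons t' m E} {F} {t} {n} (sorted-cons _ _) m≤n n≤nl sF _ =
  push-lev-mono {nl} {ol} {F} {t} {t'} sF m≤n n≤nl

flatMerge-sorted : ∀ {nl ol E F} → Sorted E → lev E ≤ nl → Sorted F → len F ≡ ol →
                   Sorted (flatMerge E nl ol F)
flatMerge-sorted {nl} sorted-nil _ sF _ = drop-sorted sF nl
flatMerge-sorted (sorted-cons sE p) n≤nl sF lenF =
  sorted-cons (flatMerge-sorted sE (≤-trans p n≤nl) sF lenF) (lev-flatMerge≤push sE p n≤nl sF lenF)

flatten : Env → Env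
flatten nil                 = nil
flatten (cons t l e)        = cons t l (flatten e)
flatten (merge e₁ nl ol e₂) = flatMerge (flatten e₁) nl ol (flatten e₂)

flatten-sorted : ∀ {e} → WFEnv e → Sorted (flatten e)
flatten-len    : ∀ {e} → WFEnv e → len (flatten e) ≡ len e
flatten-lev    : ∀ {e} → WFEnv e → lev (flatten e) ≤ lev e

flatten-sorted wf-nil            = sorted-nil
flatten-sorted (wf-cons _ w l≥)  = sorted-cons (flatten-sorted w) (≤-trans (flatten-lev w) l≥)
flatten-sorted (wf-merge w₁ w₂ lev≤ len≡) =
  flatMerge-sorted (flatten-sorted w₁) (≤-trans (flatten-lev w₁) lev≤)
                   (flatten-sorted w₂) (trans (flatten-len w₂) len≡)

flatten-len wf-nil           = refl
flatten-len (wf-cons _ w _)  = cong suc (flatten-len w)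
flatten-len {merge _ nl _ _} (wf-merge w₁ w₂ _ _) =
  trans (flatMerge-len (flatten-sorted w₁) (flatten-sorted w₂))
        (cong₂ (λ m k → m + (k ∸ nl)) (flatten-len w₁) (flatten-len w₂))

flatten-lev wf-nil          = z≤n
flatten-lev (wf-cons _ _ _) = ≤-refl
flatten-lev {merge _ nl ol _} (wf-merge w₁ w₂ lev≤ _) =
  ≤-trans (flatMerge-lev (flatten-sorted w₁) (≤-trans (flatten-lev w₁) lev≤) (flatten-sorted w₂))
          (+-monoˡ-≤ (nl ∸ ol) (flatten-lev w₂))

▷*flatten : ∀ {e} → WFEnv e → e ▷E* flatten e
▷*flatten wf-nil = ε
▷*flatten {cons t l _} (wf-cons _ w _) = gmap (cons t l) cons₂ (▷*flatten w)
▷*flatten {merge e₁ nl ol e₂} (wf-merge w₁ w₂ lev≤ len≡) =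
  gmap (λ e → merge e nl ol e₂) merge₁ (▷*flatten w₁) ◅◅
  gmap (merge (flatten e₁) nl ol) merge₂ (▷*flatten w₂) ◅◅
  merge▷*flatMerge (flatten e₁) nl ol (flatten e₂) (flatten-sorted w₁) (≤-trans (flatten-lev w₁) lev≤)
                   (flatten-sorted w₂) (trans (flatten-len w₂) len≡)

push-assoc-kept : ∀ {t n nl₂ ol₃ E₂ E₃} → Sorted E₂ → ∀ k →
  push (nl₂ + ((n + (len E₂ + k)) ∸ len E₂)) ol₃ E₃ (t , n)
  ≡ push (n + (len E₂ + k)) (len E₂ + (ol₃ ∸ nl₂)) (flatMerge E₂ nl₂ ol₃ E₃) (t , n)
push-assoc-kept {t} {n} {nl₂} {ol₃} {E₂} {E₃} sE₂ k
  with pushView+ ol₃ E₃ t n (nl₂ + k) (m+[[n+[o+p]]∸o]≡n+[m+p] nl₂ n (len E₂) k)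
     | pushView+ (len E₂ + (ol₃ ∸ nl₂)) (flatMerge E₂ nl₂ ol₃ E₃) t n (len E₂ + k) refl
... | kept _ e   | kept _ f   = trans e (sym f)
... | kept p _   | pushed q _ = ⊥-elim (<⇒≱ q (+-monoʳ-≤ (len E₂) (m≤n+o⇒m∸n≤o ol₃ nl₂ p)))
... | pushed p _ | kept q _   =
  ⊥-elim (<⇒≱ p (≤-trans (m≤n+m∸n ol₃ nl₂) (+-monoʳ-≤ nl₂ (+-cancelˡ-≤ (len E₂) _ _ q))))
... | pushed p e | pushed _ f =
  trans e (trans (suspendedEntry-cong rest-ol rest-env rest-lev) (sym f))
  where
    rest-ol : ol₃ ∸ (nl₂ + k) ≡ (len E₂ + (ol₃ ∸ nl₂)) ∸ (len E₂ + k)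
    rest-ol = sym (trans ([m+n]∸[m+o]≡n∸o (len E₂) (ol₃ ∸ nl₂) k) (∸-+-assoc ol₃ nl₂ k))
    rest-env : drop (nl₂ + k) E₃ ≡ drop (len E₂ + k) (flatMerge E₂ nl₂ ol₃ E₃)
    rest-env = sym (drop-flatMerge-past sE₂ k)
    rest-lev : (nl₂ + ((n + (len E₂ + k)) ∸ len E₂)) ∸ ol₃
               ≡ (n + (len E₂ + k)) ∸ (len E₂ + (ol₃ ∸ nl₂))
    rest-lev = [m+[n∸o]]∸p≡n∸[o+[p∸m]] nl₂ (n + (len E₂ + k)) (len E₂) ol₃
                                        (≤-trans (m≤m+n nl₂ k) (<⇒≤ p))

susp-susp▷*flatMerge : ∀ {t ol₁ nl₁ ol₂ nl₂ E F} →
  Sorted E → lev E ≤ nl₁ → Sorted F → len F ≡ ol₂ →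
  susp (susp t ol₁ nl₁ E) ol₂ nl₂ F
  ▷T* susp t (ol₁ + (ol₂ ∸ nl₁)) (nl₂ + (nl₁ ∸ ol₂)) (flatMerge E nl₁ ol₂ F)
susp-susp▷*flatMerge {t} {ol₁} {nl₁} {ol₂} {nl₂} {E} {F} sE lev≤ sF len≡ =
  rootT m1 ◅ gmap (susp t (ol₁ + (ol₂ ∸ nl₁)) (nl₂ + (nl₁ ∸ ol₂))) susp₂
                  (merge▷*flatMerge E nl₁ ol₂ F sE lev≤ sF len≡)

lev-flatMerge-at-lev : ∀ {r Y Z} → Sorted Y → 0 < len Y → 0 < r →
                    lev (flatMerge Y (lev Y) r Z) ≡ lev Z + (lev Y ∸ r)
lev-flatMerge-at-lev {r} {cons s l _} {Z} (sorted-cons _ _) _ 0<r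
  with pushView+ r Z s l 0 (sym (+-identityʳ l))
... | kept r≤0 _ = ⊥-elim (<⇒≱ 0<r r≤0)
... | pushed _ e = cong proj₂ e

suspend-suspended : ∀ {t o x r Y Z} → Sorted Y → 0 < len Y → Sorted Z → len Z ≡ r → 0 < r →
  suspendedEntry (susp t o (lev Y) Y) r Z ((lev Y + x) ∸ r)
  ▷ₑ* suspendedEntry t (o + (r ∸ lev Y)) (flatMerge Y (lev Y) r Z) (x ∸ (r ∸ lev Y))
suspend-suspended {t} {o} {x} {r} {Y} {Z} sY 0<lenY sZ lenZ 0<r = term▷ , level≡
  where
    X : Env
    X = flatMerge Y (lev Y) r Z
    levX : lev X ≡ lev Z + (lev Y ∸ r)
    levX = lev-flatMerge-at-lev sY 0<lenY 0<r
    term▷ : susp (susp t o (lev Y) Y) r (lev Z) Z ▷T* susp t (o + (r ∸ lev Y)) (lev X) X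
    term▷ = begin
      susp (susp t o (lev Y) Y) r (lev Z) Z
        ⟶*⟨ susp-susp▷*flatMerge sY ≤-refl sZ lenZ ⟩
      susp t (o + (r ∸ lev Y)) (lev Z + (lev Y ∸ r)) X
        ≡⟨ cong (λ nl → susp t (o + (r ∸ lev Y)) nl X) (sym levX) ⟩
      susp t (o + (r ∸ lev Y)) (lev X) X ∎
      where open StarReasoning _▷T_
    level≡ : lev Z + ((lev Y + x) ∸ r) ≡ lev X + (x ∸ (r ∸ lev Y))
    level≡ = begin
      lev Z + ((lev Y + x) ∸ r)
        ≡⟨ cong (lev Z +_) ([m+n]∸o≡[m∸o]+[n∸[o∸m]] (lev Y) x r) ⟩
      lev Z + ((lev Y ∸ r) + (x ∸ (r ∸ lev Y)))
        ≡⟨ sym (+-assoc (lev Z) (lev Y ∸ r) _) ⟩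
      (lev Z + (lev Y ∸ r)) + (x ∸ (r ∸ lev Y))
        ≡⟨ cong (_+ (x ∸ (r ∸ lev Y))) (sym levX) ⟩
      lev X + (x ∸ (r ∸ lev Y)) ∎
      where open ≡-Reasoning

suspended-assoc : ∀ {t o x nl₂ ol₃ Y E₃} →
  Sorted Y → 0 < len Y → lev Y ≤ nl₂ → Sorted E₃ → len E₃ ≡ ol₃ →
  push (nl₂ + x) ol₃ E₃ (suspendedEntry t o Y x)
  ▷ₑ* suspendedEntry t (o + (ol₃ ∸ nl₂)) (flatMerge Y nl₂ ol₃ E₃) (x ∸ (ol₃ ∸ nl₂))
suspended-assoc {t} {o} {x} {nl₂} {ol₃} {Y} {E₃} sY 0<lenY lev≤ sE₃ len₃
  with nl₂ ∸ lev Y | m∸n+n≡m lev≤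
... | d₂ | refl
  with pushView+ ol₃ E₃ (susp t o (lev Y) Y) (lev Y + x) d₂
                 (trans (+-assoc d₂ (lev Y) x) (+-comm d₂ (lev Y + x)))
... | kept ol₃≤d₂ e =
  ▷ₑ*-reflexive (trans e (suspendedEntry-cong (sym (trans (cong (o +_) j≡0) (+-identityʳ o)))
                                              (sym Y≡) (cong (x ∸_) (sym j≡0))))
  where
    j≡0 : ol₃ ∸ (d₂ + lev Y) ≡ 0
    j≡0 = m≤n⇒m∸n≡0 (≤-trans ol₃≤d₂ (m≤m+n d₂ (lev Y)))
    Y≡ : flatMerge Y (d₂ + lev Y) ol₃ E₃ ≡ Y
    Y≡ = flatMerge-skip sY sE₃ len₃ (+-monoˡ-≤ (lev Y) ol₃≤d₂)
... | pushed d₂<ol₃ e with m≤n⇒∃[o]m+o≡n (<⇒≤ d₂<ol₃)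
...   | r , refl =
  subst₂ _▷ₑ*_ (sym (trans e (suspendedEntry-cong (m+n∸m≡n d₂ r) refl lev≡)))
               (suspendedEntry-cong (cong (o +_) r∸l) (sym X≡) (cong (x ∸_) r∸l))
               (suspend-suspended sY 0<lenY (drop-sorted sE₃ d₂) lenZ 0<r)
  where
    r∸l : r ∸ lev Y ≡ (d₂ + r) ∸ (d₂ + lev Y)
    r∸l = sym ([m+n]∸[m+o]≡n∸o d₂ r (lev Y))
    lev≡ : ((d₂ + lev Y) + x) ∸ (d₂ + r) ≡ (lev Y + x) ∸ r
    lev≡ = trans (cong (_∸ (d₂ + r)) (+-assoc d₂ (lev Y) x)) ([m+n]∸[m+o]≡n∸o d₂ (lev Y + x) r)
    lenZ : len (drop d₂ E₃) ≡ r
    lenZ = trans (len-drop sE₃ d₂) (trans (cong (_∸ d₂) len₃) (m+n∸m≡n d₂ r))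
    0<r : 0 < r
    0<r = +-cancelˡ-< d₂ 0 r (subst (_< d₂ + r) (sym (+-identityʳ d₂)) d₂<ol₃)
    X≡ : flatMerge Y (d₂ + lev Y) (d₂ + r) E₃ ≡ flatMerge Y (lev Y) r (drop d₂ E₃)
    X≡ = flatMerge-drop sY ≤-refl sE₃ d₂ (subst (d₂ ≤_) (sym len₃) (m≤m+n d₂ r))

push-into-flatMerge : ∀ {t n d j nl₂ ol₃ E₂ E₃} → Sorted E₂ → d < len E₂ →
  push (n + d) (len E₂ + j) (flatMerge E₂ nl₂ ol₃ E₃) (t , n)
  ≡ suspendedEntry t ((len E₂ ∸ d) + j) (flatMerge (drop d E₂) nl₂ ol₃ E₃)
                     (((n + d) ∸ len E₂) ∸ j)
push-into-flatMerge {t} {n} {d} {j} {nl₂} {ol₃} {E₂} {E₃} sE₂ d<len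
  with pushView+ (len E₂ + j) (flatMerge E₂ nl₂ ol₃ E₃) t n d refl
... | kept len+j≤d _ = ⊥-elim (<⇒≱ d<len (≤-trans (m≤m+n (len E₂) j) len+j≤d))
... | pushed _ e =
  trans e (suspendedEntry-cong (+-∸-comm j (<⇒≤ d<len)) rest-env
                               (sym (∸-+-assoc (n + d) (len E₂) j)))
  where
    rest-env : drop d (flatMerge E₂ nl₂ ol₃ E₃) ≡ flatMerge (drop d E₂) nl₂ ol₃ E₃
    rest-env = trans (drop-flatMerge sE₂ d)
                     (cong (λ nl → flatMerge (drop d E₂) nl ol₃ E₃)
                           (trans (cong (nl₂ +_) (m≤n⇒m∸n≡0 (<⇒≤ d<len))) (+-identityʳ nl₂)))

push-assoc : ∀ {t n nl₁ nl₂ ol₃ E₂ E₃} →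
  Sorted E₂ → Sorted E₃ → lev E₂ ≤ nl₂ → len E₃ ≡ ol₃ → n ≤ nl₁ →
  push (nl₂ + (nl₁ ∸ len E₂)) ol₃ E₃ (push nl₁ (len E₂) E₂ (t , n))
  ▷ₑ* push nl₁ (len E₂ + (ol₃ ∸ nl₂)) (flatMerge E₂ nl₂ ol₃ E₃) (t , n)
push-assoc {t} {n} {E₂ = E₂} sE₂ _ _ _ n≤nl₁ with m≤n⇒∃[o]m+o≡n n≤nl₁
... | d , refl with pushView+ (len E₂) E₂ t n d refl
... | kept len≤d e with m≤n⇒∃[o]m+o≡n len≤d
...   | k , refl rewrite e = ▷ₑ*-reflexive (push-assoc-kept sE₂ k)
push-assoc {E₂ = E₂} sE₂ sE₃ lev≤ len₃ _ | d , refl | pushed d<len e rewrite e =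
  subst₂ _▷ₑ*_ refl (sym (push-into-flatMerge sE₂ d<len))
    (suspended-assoc (drop-sorted sE₂ d) 0<len (≤-trans (lev-drop≤lev sE₂ d) lev≤) sE₃ len₃)
  where
    0<len : 0 < len (drop d E₂)
    0<len = subst (0 <_) (sym (len-drop sE₂ d)) (m<n⇒0<n∸m d<len)

flatMerge-assoc : ∀ {nl₁ ol₂ nl₂ ol₃ E₁ E₂ E₃} → Sorted E₁ → Sorted E₂ → Sorted E₃ →
  lev E₁ ≤ nl₁ → lev E₂ ≤ nl₂ → len E₂ ≡ ol₂ → len E₃ ≡ ol₃ →
  flatMerge (flatMerge E₁ nl₁ ol₂ E₂) (nl₂ + (nl₁ ∸ ol₂)) ol₃ E₃
  ▷E* flatMerge E₁ nl₁ (ol₂ + (ol₃ ∸ nl₂)) (flatMerge E₂ nl₂ ol₃ E₃)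
flatMerge-assoc {nl₁} sorted-nil sE₂ _ _ _ refl _ = reflexive _▷E_ (sym (drop-flatMerge sE₂ nl₁))
flatMerge-assoc (sorted-cons sE₁ p) sE₂ sE₃ n≤nl₁ lev₂≤ refl len₃ =
  ∷ₑ-▷* (push-assoc sE₂ sE₃ lev₂≤ len₃ n≤nl₁)
        (flatMerge-assoc sE₁ sE₂ sE₃ (≤-trans p n≤nl₁) lev₂≤ refl len₃)

lemma3p10 : (e₁ e₂ e₃ : Env) (nl₁ ol₂ nl₂ ol₃ : ℕ) →
    WFEnv (merge (merge e₁ nl₁ ol₂ e₂) (nl₂ + (nl₁ ∸ ol₂)) ol₃ e₃) →
    WFEnv (merge e₁ nl₁ (ol₂ + (ol₃ ∸ nl₂)) (merge e₂ nl₂ ol₃ e₃)) →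
    Σ Env (λ C → Simple C ×
      (merge (merge e₁ nl₁ ol₂ e₂) (nl₂ + (nl₁ ∸ ol₂)) ol₃ e₃) ▷E* C ×
      (merge e₁ nl₁ (ol₂ + (ol₃ ∸ nl₂)) (merge e₂ nl₂ ol₃ e₃)) ▷E* C)
lemma3p10 e₁ e₂ e₃ nl₁ ol₂ nl₂ ol₃
          wA@(wf-merge (wf-merge w₁ w₂ lev₁≤ len₂≡) w₃ _ len₃≡)
          wB@(wf-merge _ (wf-merge _ _ lev₂≤ _) _ _) =
  _ , Sorted⇒Simple (flatten-sorted wB) ,
  ▷*flatten wA ◅◅ flatMerge-assoc (flatten-sorted w₁) (flatten-sorted w₂) (flatten-sorted w₃)
                                  (≤-trans (flatten-lev w₁) lev₁≤) (≤-trans (flatten-lev w₂) lev₂≤)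
                                  (trans (flatten-len w₂) len₂≡) (trans (flatten-len w₃) len₃≡) ,
  ▷*flatten wB
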